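{- Trace-prefixed hypertrace logic is strictly more expressive than its fragment with only constrained trace quantifiers: every formula of the fragment is a trace-prefixed hypertrace formula, and there is a trace-prefixed hypertrace formula $\varphi$ such that no trace-prefixed hypertrace formula $\varphi'$ without unconstrained trace quantifiers satisfies $\mathcal{L}(\varphi')=\mathcal{L}(\varphi)$.
   Context: Fix a finite set $\mathcal{X}$ of propositional variables; a trace is an infinite sequence of subsets of $\mathcal{X}$, $(2^{\mathcal{X}})^\omega$ the set of all traces. Hypertrace formulas over trace variables and disjoint time variables: $\varphi ::= \exists\pi\,\varphi \mid \exists^{T}\pi\,\varphi \mid \exists i\,\varphi \mid \neg\varphi \mid \varphi\vee\varphi \mid i<j \mid i=j \mid x(\pi,i)$, $x\in\mathcal{X}$; $\exists\pi$ is an unconstrained trace quantifier, $\exists^T\pi$ a constrained trace quantifier; $\forall,\forall^T$ dual abbreviations. Semantics over $T\subseteq(2^{\mathcal{X}})^\omega$ with a trace and a time assignment: $\exists\pi$ ranges over all of $(2^{\mathcal{X}})^\omega$, $\exists^T\pi$ over $T$, $\exists i$ over $\mathbb{N}$; $<,=$ as in $\mathbb{N}$; $x(\pi,i)$ holds iff $x$ belongs to the valuation at position (value of $i$) of the trace assigned to $\pi$. $T\models\varphi$ iff some assignments satisfy $\varphi$ over $T$; $\mathcal{L}(\varphi)=\{T\mid T\models\varphi\}$. Trace-prefixed hypertrace formulas are those generated by $\varphi ::= \exists\pi\,\varphi\mid\exists^T\pi\,\varphi\mid\neg\varphi\mid\psi$, $\psi ::= \exists i\,\psi\mid\psi\vee\psi\mid\neg\psi\mid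 i<j\mid i=j\mid x(\pi,i)$ (all trace quantifiers precede all time quantifiers). -}

module Defs where

open import Data.Nat using (ℕ; _<_; _≟_)
open import Data.Fin using (Fin)
open import Data.Bool using (Bool; true)
open import Data.Product using (Σ; _×_)
open import Data.Sum using (_⊎_)
open import Relation.Nullary using (¬_; yes; no)
open import Relation.Binary.PropositionalEquality using (_≡_)

-- Propositional variables: 𝒳 = Fin n.
-- A trace is an infinite sequence of subsets of 𝒳 (subset = characteristic function).
Trace : ℕ → Set
Trace n = ℕ → Fin n → Bool

TraceSet : ℕ → Set₁
TraceSet n = Trace n → Set

-- Trace variables and time variables are both named by natural numbers;
-- they live in separate namespaces (separate assignments), hence are disjoint.
TraceVar : Set
TraceVar = ℕ

TimeVar : Set
TimeVar = ℕ

data Formula (n : ℕ) : Set where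
  ∃π    : TraceVar → Formula n → Formula n
  ∃ᵀπ   : TraceVar → Formula n → Formula n
  ∃i    : TimeVar → Formula n → Formula n
  ¬f    : Formula n → Formula n
  _∨f_  : Formula n → Formula n → Formula n
  _<f_  : TimeVar → TimeVar → Formula n
  _=f_  : TimeVar → TimeVar → Formula n
  atom  : Fin n → TraceVar → TimeVar → Formula n

data TimeFormula {n : ℕ} : Formula n → Set where
  tf-∃i   : ∀ i {ψ} → TimeFormula ψ → TimeFormula (∃i i ψ)
  tf-∨    : ∀ {ψ χ} → TimeFormula ψ → TimeFormula χ → TimeFormula (ψ ∨f χ)
  tf-¬    : ∀ {ψ} → TimeFormula ψ → TimeFormula (¬f ψ)
  tf-<    : ∀ i j → TimeFormula (i <f j)
  tf-=    : ∀ i j → TimeFormula (i =f j)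
  tf-atom : ∀ x π i → TimeFormula (atom x π i)

data TracePrefixed {n : ℕ} : Formula n → Set where
  tp-∃π  : ∀ π {φ} → TracePrefixed φ → TracePrefixed (∃π π φ)
  tp-∃ᵀπ : ∀ π {φ} → TracePrefixed φ → TracePrefixed (∃ᵀπ π φ)
  tp-¬   : ∀ {φ} → TracePrefixed φ → TracePrefixed (¬f φ)
  tp-ψ   : ∀ {ψ} → TimeFormula ψ → TracePrefixed ψ

data ConstrainedTracePrefixed {n : ℕ} : Formula n → Set where
  ctp-∃ᵀπ : ∀ π {φ} → ConstrainedTracePrefixed φ → ConstrainedTracePrefixed (∃ᵀπ π φ)
  ctp-¬   : ∀ {φ} → ConstrainedTracePrefixed φ → ConstrainedTracePrefixed (¬f φ)
  ctp-ψ   : ∀ {ψ} → TimeFormula ψ → ConstrainedTracePrefixed ψ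

update : {A : Set} → (ℕ → A) → ℕ → A → ℕ → A
update f k a m with m ≟ k
... | yes _ = a
... | no  _ = f m

Sat : {n : ℕ} → TraceSet n → (TraceVar → Trace n) → (TimeVar → ℕ) → Formula n → Set
Sat T Π I (∃π π φ)    = Σ (Trace _) λ t → Sat T (update Π π t) I φ
Sat T Π I (∃ᵀπ π φ)   = Σ (Trace _) λ t → T t × Sat T (update Π π t) I φ
Sat T Π I (∃i i φ)    = Σ ℕ λ k → Sat T Π (update I i k) φ
Sat T Π I (¬f φ)      = ¬ Sat T Π I φ
Sat T Π I (φ ∨f χ)    = Sat T Π I φ ⊎ Sat T Π I χ
Sat T Π I (i <f j)    = I i < I j
Sat T Π I (i =f j)    = I i ≡ I j
Sat T Π I (atom x π i) = Π π (I i) x ≡ true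

_⊨_ : {n : ℕ} → TraceSet n → Formula n → Set
T ⊨ φ = Σ (TraceVar → Trace _) λ Π → Σ (TimeVar → ℕ) λ I → Sat T Π I φ

SameLanguage : {n : ℕ} → Formula n → Formula n → Set₁
SameLanguage φ φ' = ∀ (T : TraceSet _) → (T ⊨ φ → T ⊨ φ') × (T ⊨ φ' → T ⊨ φ)

{-# OPTIONS --safe #-}
module Submission where

-- The formula ∀π ∃ᵀπ′ ∀i (x₀(π,i) ↔ x₀(π′,i)) holds in the set of all traces
-- but, by Cantor's diagonal argument, in no set of traces indexed by a set that
-- injects into ℕ. A formula with only constrained trace quantifiers that holds
-- in the set of all traces also holds in such a set: the closure of the
-- assigned traces under Skolem functions for its ∃ᵀ-quantifiers (a downward
-- Löwenheim–Skolem argument). A Skolem function only depends on the finitely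
-- many variables below the formula's variable bound, so the elements of this
-- hull are named by finite trees, which serialise prefix-freely into bit
-- strings and hence inject into ℕ.

open import Defs
open import Axiom.ExcludedMiddle using (ExcludedMiddle)
open import Level using (0ℓ)
open import Data.Bool using (Bool; true; false; not)
open import Data.Bool.Properties using (not-¬)
open import Data.Fin using (zero)
open import Data.List using (List; []; _∷_)
open import Data.List.Properties using (∷-injectiveʳ)
open import Data.Nat using (ℕ; zero; suc; _⊔_; _≤_; _<_; _≟_; s≤s)
open import Data.Nat.Binary using (ℕᵇ; 2[1+_]; 1+[2_]; toℕ) renaming (zero to 0ᵇ)
open import Data.Nat.Binary.Properties using (2[1+_]-injective; 1+[2_]-injective; toℕ-injective)
open import Data.Nat.Properties using (≤-refl; ≤-trans; m≤n⊔m; m⊔n≤o⇒m≤o; m⊔n≤o⇒n≤o)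
open import Data.Product using (Σ; _×_; _,_; proj₁; proj₂; ∃-syntax; map₁)
open import Data.Sum using (_⊎_; inj₁; inj₂)
open import Data.Unit using (⊤; tt)
open import Data.Vec using (Vec; []; _∷_)
open import Function.Bundles using (_⇔_; mk⇔; Equivalence)
open import Function.Base using (_∘_)
open import Function.Definitions using (Injective)
open import Relation.Nullary using (¬_; yes; no; contradiction)
open import Relation.Binary.PropositionalEquality using (_≡_; _≢_; refl; sym; trans; cong; cong₂; subst; subst₂)

ctp⇒tp : ∀ {n} (φ : Formula n) → ConstrainedTracePrefixed φ → TracePrefixed φ
ctp⇒tp _ (ctp-∃ᵀπ π c) = tp-∃ᵀπ π (ctp⇒tp _ c)
ctp⇒tp _ (ctp-¬ c)     = tp-¬ (ctp⇒tp _ c)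
ctp⇒tp _ (ctp-ψ t)     = tp-ψ t

allTraces : ∀ {n} → TraceSet n
allTraces _ = ⊤

blank : ∀ {n} → Trace n
blank _ _ = false

Agree : {A : Set} → ℕ → (ℕ → A) → (ℕ → A) → Set
Agree N f g = ∀ m → m < N → f m ≡ g m

Agree-sym : {A : Set} {N : ℕ} {f g : ℕ → A} → Agree N f g → Agree N g f
Agree-sym f≈g m m<N = sym (f≈g m m<N)

Agree-update : {A : Set} {N : ℕ} {f g : ℕ → A} (p : ℕ) (a : A) →
               Agree N f g → Agree N (update f p a) (update g p a)
Agree-update p a f≈g m m<N with m ≟ p
... | yes _ = refl
... | no  _ = f≈g m m<N

restrict : {A : Set} (m : ℕ) → (ℕ → A) → Vec A m
restrict zero    f = []
restrict (suc m) f = f 0 ∷ restrict m (λ j → f (suc j))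

extend : {A : Set} {m : ℕ} → Vec A m → A → ℕ → A
extend []      a j       = a
extend (x ∷ v) a zero    = x
extend (x ∷ v) a (suc j) = extend v a j

extend-restrict : {A : Set} (m : ℕ) (f : ℕ → A) (a : A) → Agree m (extend (restrict m f) a) f
extend-restrict (suc m) f a zero    _         = refl
extend-restrict (suc m) f a (suc j) (s≤s j<m) = extend-restrict m (λ j → f (suc j)) a j j<m

All-update : {A : Set} {P : A → Set} {f : ℕ → A} (p : ℕ) {a : A} →
             (∀ m → P (f m)) → P a → ∀ m → P (update f p a m)
All-update p Pf Pa m with m ≟ p
... | yes _ = Pa
... | no  _ = Pf m

varBound : ∀ {n} → Formula n → ℕ
varBound (∃π p φ)     = suc p ⊔ varBound φ
varBound (∃ᵀπ p φ)    = suc p ⊔ varBound φ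
varBound (∃i i φ)     = suc i ⊔ varBound φ
varBound (¬f φ)       = varBound φ
varBound (φ ∨f χ)     = varBound φ ⊔ varBound χ
varBound (i <f j)     = suc i ⊔ suc j
varBound (i =f j)     = suc i ⊔ suc j
varBound (atom x p i) = suc p ⊔ suc i

Sat-agree : ∀ {n} (T : TraceSet n) {N : ℕ} (φ : Formula n) → varBound φ ≤ N →
            ∀ Π Π′ I I′ → Agree N Π Π′ → Agree N I I′ → Sat T Π I φ → Sat T Π′ I′ φ
Sat-agree T (∃π p φ) b Π Π′ I I′ Π≈ I≈ (t , s) =
  t , Sat-agree T φ (m⊔n≤o⇒n≤o (suc p) _ b) _ _ I I′ (Agree-update p t Π≈) I≈ s
Sat-agree T (∃ᵀπ p φ) b Π Π′ I I′ Π≈ I≈ (t , t∈T , s) =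
  t , t∈T , Sat-agree T φ (m⊔n≤o⇒n≤o (suc p) _ b) _ _ I I′ (Agree-update p t Π≈) I≈ s
Sat-agree T (∃i i φ) b Π Π′ I I′ Π≈ I≈ (k , s) =
  k , Sat-agree T φ (m⊔n≤o⇒n≤o (suc i) _ b) Π Π′ _ _ Π≈ (Agree-update i k I≈) s
Sat-agree T (¬f φ) b Π Π′ I I′ Π≈ I≈ ¬s s′ =
  ¬s (Sat-agree T φ b Π′ Π I′ I (Agree-sym Π≈) (Agree-sym I≈) s′)
Sat-agree T (φ ∨f χ) b Π Π′ I I′ Π≈ I≈ (inj₁ s) =
  inj₁ (Sat-agree T φ (m⊔n≤o⇒m≤o _ (varBound χ) b) Π Π′ I I′ Π≈ I≈ s)
Sat-agree T (φ ∨f χ) b Π Π′ I I′ Π≈ I≈ (inj₂ s) =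
  inj₂ (Sat-agree T χ (m⊔n≤o⇒n≤o (varBound φ) _ b) Π Π′ I I′ Π≈ I≈ s)
Sat-agree T (i <f j) b Π Π′ I I′ Π≈ I≈ s =
  subst₂ _<_ (I≈ i (m⊔n≤o⇒m≤o (suc i) (suc j) b)) (I≈ j (m⊔n≤o⇒n≤o (suc i) (suc j) b)) s
Sat-agree T (i =f j) b Π Π′ I I′ Π≈ I≈ s =
  subst₂ _≡_ (I≈ i (m⊔n≤o⇒m≤o (suc i) (suc j) b)) (I≈ j (m⊔n≤o⇒n≤o (suc i) (suc j) b)) s
Sat-agree T (atom x p i) b Π Π′ I I′ Π≈ I≈ s =
  subst (_≡ true) (cong₂ (λ t k → t k x) (Π≈ p (m⊔n≤o⇒m≤o (suc p) (suc i) b))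
                                        (I≈ i (m⊔n≤o⇒n≤o (suc p) (suc i) b))) s

Sat-timeFormula : ∀ {n} {ψ : Formula n} → TimeFormula ψ →
                  ∀ (T T′ : TraceSet n) Π I → Sat T Π I ψ → Sat T′ Π I ψ
Sat-timeFormula (tf-∃i i t) T T′ Π I (k , s)  = k , Sat-timeFormula t T T′ Π _ s
Sat-timeFormula (tf-∨ t u) T T′ Π I (inj₁ s)  = inj₁ (Sat-timeFormula t T T′ Π I s)
Sat-timeFormula (tf-∨ t u) T T′ Π I (inj₂ s)  = inj₂ (Sat-timeFormula u T T′ Π I s)
Sat-timeFormula (tf-¬ t) T T′ Π I ¬s s′       = ¬s (Sat-timeFormula t T′ T Π I s′)
Sat-timeFormula (tf-< i j) T T′ Π I s         = s
Sat-timeFormula (tf-= i j) T T′ Π I s         = s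
Sat-timeFormula (tf-atom x π i) T T′ Π I s    = s

-- strip k indexes the subformulas of a constrained formula, and thereby its
-- Skolem functions.
strip₁ : ∀ {n} → Formula n → Formula n
strip₁ (∃ᵀπ p φ) = φ
strip₁ (¬f φ)    = φ
strip₁ φ         = φ

strip : ∀ {n} → ℕ → Formula n → Formula n
strip zero    φ = φ
strip (suc k) φ = strip₁ (strip k φ)

varBound-strip₁ : ∀ {n} (φ : Formula n) → varBound (strip₁ φ) ≤ varBound φ
varBound-strip₁ (∃π p φ)     = ≤-refl
varBound-strip₁ (∃ᵀπ p φ)    = m≤n⊔m (suc p) (varBound φ)
varBound-strip₁ (∃i i φ)     = ≤-refl
varBound-strip₁ (¬f φ)       = ≤-refl
varBound-strip₁ (φ ∨f χ)     = ≤-refl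
varBound-strip₁ (i <f j)     = ≤-refl
varBound-strip₁ (i =f j)     = ≤-refl
varBound-strip₁ (atom x p i) = ≤-refl

varBound-strip : ∀ {n} k (φ : Formula n) → varBound (strip k φ) ≤ varBound φ
varBound-strip zero    φ = ≤-refl
varBound-strip (suc k) φ = ≤-trans (varBound-strip₁ (strip k φ)) (varBound-strip k φ)

cantor : ExcludedMiddle 0ℓ → {C : Set} {code : C → ℕ} → Injective _≡_ _≡_ code →
         (f : C → ℕ → Bool) → Σ (ℕ → Bool) λ d → ∀ c → d (code c) ≢ f c (code c)
cantor em {C} {code} code-injective f = d , d-differs
  where
  d : ℕ → Bool
  d k with em {Σ C λ c → code c ≡ k}
  ... | yes (c , _) = not (f c k)
  ... | no  _       = false

  d-differs : ∀ c → d (code c) ≢ f c (code c)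
  d-differs c with em {Σ C λ c′ → code c′ ≡ code c}
  ... | yes (c′ , e) with code-injective e
  ...   | refl = not-¬ refl ∘ sym
  d-differs c | no ∄c = contradiction (c , refl) ∄c

record CountableModel {n : ℕ} (φ : Formula n) : Set₁ where
  field
    Index           : Set
    code            : Index → ℕ
    code-injective  : Injective _≡_ _≡_ code
    member          : Index → Trace n
    members⊨        : (λ t → Σ Index λ i → member i ≡ t) ⊨ φ

CountableModel-sameLanguage : ∀ {n} {φ ψ : Formula n} → SameLanguage φ ψ → CountableModel φ → CountableModel ψ
CountableModel-sameLanguage same M = record
  { Index = Index ; code = code ; code-injective = code-injective ; member = member
  ; members⊨ = proj₁ (same _) members⊨
  }
  where open CountableModel M

PrefixInjective : {A : Set} → (A → List Bool → List Bool) → Set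
PrefixInjective ser = ∀ {a b r s} → ser a r ≡ ser b s → a ≡ b × r ≡ s

serℕ : ℕ → List Bool → List Bool
serℕ zero    r = false ∷ r
serℕ (suc m) r = true ∷ serℕ m r

serℕ-injective : PrefixInjective serℕ
serℕ-injective {zero}  {zero}  refl = refl , refl
serℕ-injective {suc a} {suc b} e    = map₁ (cong suc) (serℕ-injective (∷-injectiveʳ e))

serVec : {A : Set} {m : ℕ} → (A → List Bool → List Bool) → Vec A m → List Bool → List Bool
serVec ser []      r = r
serVec ser (x ∷ v) r = ser x (serVec ser v r)

serVec-injective : {A : Set} {m : ℕ} {ser : A → List Bool → List Bool} →
                   PrefixInjective ser → PrefixInjective (serVec {m = m} ser)
serVec-injective inj {[]}    {[]}    e = refl , e
serVec-injective inj {x ∷ v} {y ∷ w} e =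
  let x≡y , e′  = inj e
      v≡w , r≡s = serVec-injective inj e′
  in cong₂ _∷_ x≡y v≡w , r≡s

fromBits : List Bool → ℕᵇ
fromBits []          = 0ᵇ
fromBits (false ∷ l) = 2[1+ fromBits l ]
fromBits (true ∷ l)  = 1+[2 fromBits l ]

fromBits-injective : Injective _≡_ _≡_ fromBits
fromBits-injective {[]}        {[]}         _  = refl
fromBits-injective {false ∷ l} {false ∷ l′} e  = cong (false ∷_) (fromBits-injective (2[1+_]-injective e))
fromBits-injective {true ∷ l}  {true ∷ l′}  e  = cong (true ∷_) (fromBits-injective (1+[2_]-injective e))
fromBits-injective {[]}        {false ∷ _}  ()
fromBits-injective {[]}        {true ∷ _}   ()
fromBits-injective {false ∷ _} {[]}         ()
fromBits-injective {false ∷ _} {true ∷ _}   ()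
fromBits-injective {true ∷ _}  {[]}         ()
fromBits-injective {true ∷ _}  {false ∷ _}  ()

differ₀ : ∀ {n} → TraceVar → TraceVar → TimeVar → Formula (suc n)
differ₀ p q i = ¬f (¬f (atom zero p i) ∨f atom zero q i) ∨f ¬f (atom zero p i ∨f ¬f (atom zero q i))

-- Sat T Π I (differ₀ p q i) unfolds to the left-hand side with u = Π p (I i) zero
-- and v = Π q (I i) zero.
differ⇔≢ : ∀ {u v : Bool} → (¬ (¬ u ≡ true ⊎ v ≡ true) ⊎ ¬ (u ≡ true ⊎ ¬ v ≡ true)) ⇔ u ≢ v
differ⇔≢ {false} {false} = mk⇔ (λ { (inj₁ s) _ → s (inj₁ λ ()) ; (inj₂ s) _ → s (inj₂ λ ()) })
                               (λ u≢v → contradiction refl u≢v)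
differ⇔≢ {true}  {true}  = mk⇔ (λ { (inj₁ s) _ → s (inj₂ refl) ; (inj₂ s) _ → s (inj₁ refl) })
                               (λ u≢v → contradiction refl u≢v)
differ⇔≢ {true}  {false} = mk⇔ (λ _ ()) (λ _ → inj₁ λ { (inj₁ ¬t) → ¬t refl ; (inj₂ ()) })
differ⇔≢ {false} {true}  = mk⇔ (λ _ ()) (λ _ → inj₂ λ { (inj₁ ()) ; (inj₂ ¬t) → ¬t refl })

x₀-complete : ∀ {n} → Formula (suc n)
x₀-complete = ¬f (∃π 0 (¬f (∃ᵀπ 1 (¬f (∃i 0 (differ₀ 0 1 0))))))

x₀-complete-tp : ∀ {n} → TracePrefixed {suc n} x₀-complete
x₀-complete-tp = tp-¬ (tp-∃π 0 (tp-¬ (tp-∃ᵀπ 1 (tp-¬ (tp-ψ (tf-∃i 0 differ₀-tf))))))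
  where
  differ₀-tf = tf-∨ (tf-¬ (tf-∨ (tf-¬ (tf-atom _ _ _)) (tf-atom _ _ _)))
                    (tf-¬ (tf-∨ (tf-atom _ _ _) (tf-¬ (tf-atom _ _ _))))

allTraces⊨x₀-complete : ∀ {n} → allTraces {suc n} ⊨ x₀-complete
allTraces⊨x₀-complete = (λ _ → blank) , (λ _ → 0) , λ (t , unmatched) →
  unmatched (t , tt , λ (k , differs) → Equivalence.to differ⇔≢ differs refl)

x₀-complete-realises : ∀ {n} {T : TraceSet (suc n)} → T ⊨ x₀-complete →
                       (t : Trace (suc n)) → ¬ (∀ t′ → T t′ → ∃[ k ] t k zero ≢ t′ k zero)
x₀-complete-realises (Π , I , s) t avoided = s (t , λ (t′ , t′∈T , agrees) →
  let k , t≢t′ = avoided t′ t′∈T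
  in agrees (k , Equivalence.from differ⇔≢ t≢t′))

x₀-complete-uncountable : ∀ {n} → ExcludedMiddle 0ℓ → ¬ CountableModel {suc n} x₀-complete
x₀-complete-uncountable em M =
  let d , d-differs = cantor em code-injective λ c k → member c k zero
  in x₀-complete-realises members⊨ (λ k _ → d k) λ where
       _ (c , refl) → code c , d-differs c
  where open CountableModel M

module _ (em : ExcludedMiddle 0ℓ) {A : Set} (default : A) (P : A → Set) where

  choose : A
  choose with em {Σ A P}
  ... | yes (a , _) = a
  ... | no  _       = default

  choose-spec : Σ A P → P choose
  choose-spec ∃P with em {Σ A P}
  ... | yes (_ , Pa) = Pa
  ... | no  ¬∃P      = contradiction ∃P ¬∃P

module SkolemHull (em : ExcludedMiddle 0ℓ) {n : ℕ} (φ : Formula n) (Π₀ : TraceVar → Trace n) where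

  N : ℕ
  N = varBound φ

  skolem : Formula n → (TraceVar → Trace n) → (TimeVar → ℕ) → Trace n
  skolem (∃ᵀπ p ψ) Π I = choose em blank λ t → Sat allTraces (update Π p t) I ψ
  skolem _         _ _ = blank

  skolem-spec : ∀ p ψ Π I → Sat allTraces Π I (∃ᵀπ p ψ) →
                Sat allTraces (update Π p (skolem (∃ᵀπ p ψ) Π I)) I ψ
  skolem-spec p ψ Π I (t , _ , s) = choose-spec em blank _ (t , s)

  -- skolemAt k cs is names the Skolem witness for strip k φ at the traces
  -- named by cs and the times is, assigned to the variables below N.
  data Code : Set where
    base     : TraceVar → Code
    skolemAt : ℕ → Vec Code N → Vec ℕ N → Code

  mutual
    decode : Code → Trace n
    decode (base p)           = Π₀ p
    decode (skolemAt k cs is) = skolem (strip k φ) (extend (decodes cs) blank) (extend is 0)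

    decodes : ∀ {m} → Vec Code m → Vec (Trace n) m
    decodes []       = []
    decodes (c ∷ cs) = decode c ∷ decodes cs

  extend-decodes-restrict : ∀ m (f : ℕ → Code) → Agree m (extend (decodes (restrict m f)) blank) (decode ∘ f)
  extend-decodes-restrict (suc m) f zero    _         = refl
  extend-decodes-restrict (suc m) f (suc j) (s≤s j<m) = extend-decodes-restrict m (λ j → f (suc j)) j j<m

  Hull : TraceSet n
  Hull t = Σ Code λ c → decode c ≡ t

  mutual
    serCode : Code → List Bool → List Bool
    serCode (base p)           r = false ∷ serℕ p r
    serCode (skolemAt k cs is) r = true ∷ serℕ k (serCodes cs (serVec serℕ is r))

    serCodes : ∀ {m} → Vec Code m → List Bool → List Bool
    serCodes []       r = r
    serCodes (c ∷ cs) r = serCode c (serCodes cs r)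

  mutual
    serCode-injective : PrefixInjective serCode
    serCode-injective {base _} {base _} e = map₁ (cong base) (serℕ-injective (∷-injectiveʳ e))
    serCode-injective {skolemAt k cs is} {skolemAt k′ cs′ is′} e
      with refl , e₁  ← serℕ-injective {k} {k′} (∷-injectiveʳ e)
      with refl , e₂  ← serCodes-injective {a = cs} {cs′} e₁
      with refl , r≡s ← serVec-injective serℕ-injective {is} {is′} e₂
      = refl , r≡s

    serCodes-injective : ∀ {m} → PrefixInjective (serCodes {m})
    serCodes-injective {a = []}     {[]}     e = refl , e
    serCodes-injective {a = c ∷ cs} {d ∷ ds} e =
      let c≡d , e′ = serCode-injective e
          cs≡ds , r≡s = serCodes-injective e′
      in cong₂ _∷_ c≡d cs≡ds , r≡s

  encode : Code → ℕ
  encode c = toℕ (fromBits (serCode c []))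

  encode-injective : Injective _≡_ _≡_ encode
  encode-injective e = proj₁ (serCode-injective (fromBits-injective (toℕ-injective e)))

  skolem∈Hull : ∀ k {p ψ} → strip k φ ≡ ∃ᵀπ p ψ → ∀ {Π} I → (∀ m → Hull (Π m)) →
                Sat allTraces Π I (∃ᵀπ p ψ) → Σ (Trace n) λ t → Hull t × Sat allTraces (update Π p t) I ψ
  skolem∈Hull k {p} {ψ} e {Π} I Π∈Hull s =
    decode c , (c , refl) ,
    Sat-agree allTraces ψ bound _ _ I′ I (Agree-update p (decode c) (Agree-sym Π≈)) (Agree-sym I≈) s′
    where
    cs = restrict N (λ m → proj₁ (Π∈Hull m))
    c  = skolemAt k cs (restrict N I)
    Π′ = extend (decodes cs) blank
    I′ = extend (restrict N I) 0

    Π≈ : Agree N Π Π′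
    Π≈ m m<N = trans (sym (proj₂ (Π∈Hull m))) (sym (extend-decodes-restrict N _ m m<N))

    I≈ : Agree N I I′
    I≈ = Agree-sym (extend-restrict N I 0)

    boundχ : varBound (∃ᵀπ p ψ) ≤ N
    boundχ = subst (λ χ → varBound χ ≤ N) e (varBound-strip k φ)

    bound : varBound ψ ≤ N
    bound = m⊔n≤o⇒n≤o (suc p) _ boundχ

    c-is-skolem : decode c ≡ skolem (∃ᵀπ p ψ) Π′ I′
    c-is-skolem = cong (λ χ → skolem χ Π′ I′) e

    s′ : Sat allTraces (update Π′ p (decode c)) I′ ψ
    s′ = subst (λ t → Sat allTraces (update Π′ p t) I′ ψ) (sym c-is-skolem)
               (skolem-spec p ψ Π′ I′ (Sat-agree allTraces (∃ᵀπ p ψ) boundχ Π Π′ I I′ Π≈ I≈ s))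

  Sat-Hull⇔ : ∀ k {χ} → strip k φ ≡ χ → ConstrainedTracePrefixed χ →
              ∀ {Π} I → (∀ m → Hull (Π m)) → Sat allTraces Π I χ ⇔ Sat Hull Π I χ
  Sat-Hull⇔ k e (ctp-ψ t) {Π} I _ =
    mk⇔ (Sat-timeFormula t allTraces Hull Π I) (Sat-timeFormula t Hull allTraces Π I)
  Sat-Hull⇔ k e (ctp-¬ c) I Π∈Hull = mk⇔ (λ ¬s s → ¬s (from ih s)) (λ ¬s s → ¬s (to ih s))
    where
    open Equivalence
    ih = Sat-Hull⇔ (suc k) (cong strip₁ e) c I Π∈Hull
  Sat-Hull⇔ k {∃ᵀπ p ψ} e (ctp-∃ᵀπ p c) {Π} I Π∈Hull = mk⇔ forth back
    where
    open Equivalence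
    ih : ∀ {Π} → (∀ m → Hull (Π m)) → Sat allTraces Π I ψ ⇔ Sat Hull Π I ψ
    ih = Sat-Hull⇔ (suc k) (cong strip₁ e) c I

    forth : Sat allTraces Π I (∃ᵀπ p ψ) → Sat Hull Π I (∃ᵀπ p ψ)
    forth s = let t , t∈Hull , sψ = skolem∈Hull k e I Π∈Hull s
              in t , t∈Hull , to (ih (All-update {P = Hull} p Π∈Hull t∈Hull)) sψ

    back : Sat Hull Π I (∃ᵀπ p ψ) → Sat allTraces Π I (∃ᵀπ p ψ)
    back (t , t∈Hull , sψ) = t , tt , from (ih (All-update {P = Hull} p Π∈Hull t∈Hull)) sψ

  countableModel : ConstrainedTracePrefixed φ → ∀ I → Sat allTraces Π₀ I φ → CountableModel φ
  countableModel c I s = record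
    { Index          = Code
    ; code           = encode
    ; code-injective = encode-injective
    ; member         = decode
    ; members⊨       = Π₀ , I , Equivalence.to (Sat-Hull⇔ 0 refl c I (λ m → base m , refl)) s
    }

constrained⇒countableModel : ExcludedMiddle 0ℓ → ∀ {n} {φ : Formula n} →
                             ConstrainedTracePrefixed φ → allTraces ⊨ φ → CountableModel φ
constrained⇒countableModel em c (Π₀ , I , s) = SkolemHull.countableModel em _ Π₀ c I s

proposition1 : ExcludedMiddle 0ℓ → (n : ℕ) →
    ((φ : Formula (suc n)) → ConstrainedTracePrefixed φ → TracePrefixed φ)
    × Σ (Formula (suc n)) (λ φ → TracePrefixed φ
        × ((φ' : Formula (suc n)) → ConstrainedTracePrefixed φ' → ¬ SameLanguage φ' φ))
proposition1 em n = ctp⇒tp , x₀-complete , x₀-complete-tp , not-constrained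
  where
  not-constrained : (φ′ : Formula (suc n)) → ConstrainedTracePrefixed φ′ → ¬ SameLanguage φ′ x₀-complete
  not-constrained φ′ c same =
    x₀-complete-uncountable em
      (CountableModel-sameLanguage same
        (constrained⇒countableModel em c (proj₂ (same allTraces) allTraces⊨x₀-complete)))
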